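{- Two pointed models $(\mathcal{M},s)$ and $(\mathcal{M}',s')$ satisfy the same formulas of $\mathcal{L}_1$ if and only if they are bisimilar.
   Context: Fix a set of constants $\mathbb{C}$. The language $\mathcal{L}_1$ is given by $\varphi ::= \top \mid \lnot\varphi \mid \varphi\land\varphi \mid \mathit{Kv}(c) \mid [c]\varphi$ with $c\in\mathbb{C}$. A model is $\mathcal{M}=\langle S,\mathcal{D},V\rangle$ with $S$ a non-empty set of states, $\mathcal{D}$ a non-empty domain, $V:S\times\mathbb{C}\to\mathcal{D}$; $s=_c t$ means $V(s,c)=V(t,c)$, $s\neq_c t$ its negation, and $s=_C t$ means $s=_c t$ for all $c\in C$. Semantics: booleans as usual; $\mathcal{M},s\vDash\mathit{Kv}(c)$ iff $s=_c t$ for all $t\in S$; $\mathcal{M},s\vDash[c]\varphi$ iff $\mathcal{M}|^s_c,s\vDash\varphi$, where $\mathcal{M}|^s_c=\langle S',\mathcal{D},V|_{S'\times\mathbb{C}}\rangle$ with $S'=\{t\in S\mid s=_c t\}$. Pointed models $(\langle S,\mathcal{D},V\rangle,s)$ and $(\langle S',\mathcal{D}',V'\rangle,s')$ are bisimilar iff (i) for every finite $C\subseteq\mathbb{C}$ and every $d\in\mathbb{C}$, if there is $t\in S$ with $s=_C t$ and $s\neq_d t$, then there is $t'\in S'$ with $s'=_C t'$ and $s'\neq_d t'$; and (ii) vice versa. -}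

module Defs where

open import Data.Product using (Σ; Σ-syntax; ∃-syntax; _×_; _,_; proj₁)
open import Data.Unit using (⊤)
open import Data.List using (List)
open import Data.List.Relation.Unary.All using (All)
open import Relation.Nullary using (¬_)
open import Relation.Binary.PropositionalEquality using (_≡_)

module Language (Const : Set) where

  data Form : Set where
    ⊤f   : Form
    ¬f_  : Form → Form
    _∧f_ : Form → Form → Form
    Kv   : Const → Form
    [_]_ : Const → Form → Form

  -- A model ⟨S, D, V⟩.  Non-emptiness of S (and hence of D) is witnessed by
  -- the designated state of a pointed model.
  record Model : Set₁ where
    field
      S : Set
      D : Set
      V : S → Const → D

  open Model public

  _≐[_]_ : {M : Model} → S M → Const → S M → Set
  _≐[_]_ {M} s c t = V M s c ≡ V M t c

  _≐*[_]_ : {M : Model} → S M → List Const → S M → Set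
  _≐*[_]_ {M} s C t = All (λ c → _≐[_]_ {M} s c t) C

  restrict : (M : Model) → S M → Const → Model
  restrict M s c = record
    { S = Σ[ t ∈ S M ] (V M s c ≡ V M t c)
    ; D = D M
    ; V = λ t' d → V M (proj₁ t') d
    }

  restrict-pt : (M : Model) (s : S M) (c : Const) → S (restrict M s c)
  restrict-pt M s c = s , Relation.Binary.PropositionalEquality.refl

  _,_⊨_ : (M : Model) → S M → Form → Set
  M , s ⊨ ⊤f      = ⊤
  M , s ⊨ (¬f φ)  = ¬ (M , s ⊨ φ)
  M , s ⊨ (φ ∧f ψ) = (M , s ⊨ φ) × (M , s ⊨ ψ)
  M , s ⊨ Kv c    = ∀ (t : S M) → V M s c ≡ V M t c
  M , s ⊨ ([ c ] φ) = restrict M s c , restrict-pt M s c ⊨ φ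

  SameTheory : (M : Model) → S M → (M' : Model) → S M' → Set
  SameTheory M s M' s' =
    ∀ (φ : Form) → ((M , s ⊨ φ) → (M' , s' ⊨ φ)) × ((M' , s' ⊨ φ) → (M , s ⊨ φ))

  BisimHalf : (M : Model) → S M → (M' : Model) → S M' → Set
  BisimHalf M s M' s' =
    ∀ (C : List Const) (d : Const) →
      (Σ[ t ∈ S M ] (_≐*[_]_ {M} s C t × ¬ (V M s d ≡ V M t d))) →
      (Σ[ t' ∈ S M' ] (_≐*[_]_ {M'} s' C t' × ¬ (V M' s' d ≡ V M' t' d)))

  Bisimilar : (M : Model) → S M → (M' : Model) → S M' → Set
  Bisimilar M s M' s' = BisimHalf M s M' s' × BisimHalf M' s' M s

-- A state t with s =_C t and s ≠_d t exists exactly when s ⊨ [c₁]…[cₙ]¬Kv d,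
-- where C = c₁ … cₙ; so agreeing on these formulas is bisimilarity.  Conversely,
-- a bisimulation survives an announcement [c] (witnesses for C below it are
-- witnesses for c ∷ C above it) and decides Kv (a witness for the empty C
-- refutes Kv), so truth is invariant by induction on formulas.
module Submission where

open import Defs
open import Level using (0ℓ)
open import Data.Product using (Σ-syntax; _×_; _,_; proj₁; proj₂)
open import Data.List using (List; []; _∷_)
open import Data.List.Relation.Unary.All using ([]; _∷_)
open import Relation.Nullary using (¬_)
open import Relation.Binary.PropositionalEquality using (_≡_)
open import Axiom.ExcludedMiddle using (ExcludedMiddle)
open import Axiom.DoubleNegationElimination using (DoubleNegationElimination; em⇒dne)

¬∀⇒∃¬ : ∀ {ℓ} → DoubleNegationElimination ℓ →
  {A : Set ℓ} {P : A → Set ℓ} → ¬ (∀ x → P x) → Σ[ x ∈ A ] ¬ P x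
¬∀⇒∃¬ dne ¬∀P = dne λ ¬∃¬P → ¬∀P λ x → dne λ ¬Px → ¬∃¬P (x , ¬Px)

module _ {Const : Set} where
  open Language Const

  Distinguishable : (M : Model) → S M → List Const → Const → Set
  Distinguishable M s C d = Σ[ t ∈ S M ] (_≐*[_]_ {M} s C t × ¬ (V M s d ≡ V M t d))

  module _ {M : Model} {s : S M} {c : Const} {C : List Const} {d : Const} where

    distinguishable-restrict :
      Distinguishable M s (c ∷ C) d → Distinguishable (restrict M s c) (restrict-pt M s c) C d
    distinguishable-restrict (t , s≐t ∷ s≐*t , s≠t) = (t , s≐t) , s≐*t , s≠t

    restrict-distinguishable :
      Distinguishable (restrict M s c) (restrict-pt M s c) C d → Distinguishable M s (c ∷ C) d
    restrict-distinguishable ((t , s≐t) , s≐*t , s≠t) = t , s≐t ∷ s≐*t , s≠t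

  module _ {M : Model} {s : S M} {M' : Model} {s' : S M'} where

    BisimHalf-restrict : (c : Const) → BisimHalf M s M' s' →
      BisimHalf (restrict M s c) (restrict-pt M s c) (restrict M' s' c) (restrict-pt M' s' c)
    BisimHalf-restrict c h C d w =
      distinguishable-restrict (h (c ∷ C) d (restrict-distinguishable w))

    BisimHalf-reflects-Kv : DoubleNegationElimination 0ℓ → (c : Const) →
      BisimHalf M s M' s' → M' , s' ⊨ Kv c → M , s ⊨ Kv c
    BisimHalf-reflects-Kv dne c h kv t = dne λ s≠t →
      let (t' , _ , s'≠t') = h [] c (t , [] , s≠t) in s'≠t' (kv t')

  ⊨-invariant : DoubleNegationElimination 0ℓ → (φ : Form) →
    {M : Model} {s : S M} {M' : Model} {s' : S M'} → Bisimilar M s M' s' →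
    ((M , s ⊨ φ) → (M' , s' ⊨ φ)) × ((M' , s' ⊨ φ) → (M , s ⊨ φ))
  ⊨-invariant dne ⊤f b = (λ x → x) , (λ x → x)
  ⊨-invariant dne (¬f φ) b =
    let (⇒ , ⇐) = ⊨-invariant dne φ b in (λ ¬x y → ¬x (⇐ y)) , (λ ¬y x → ¬y (⇒ x))
  ⊨-invariant dne (φ ∧f ψ) b =
    let (⇒φ , ⇐φ) = ⊨-invariant dne φ b
        (⇒ψ , ⇐ψ) = ⊨-invariant dne ψ b
    in (λ (x , y) → ⇒φ x , ⇒ψ y) , (λ (x , y) → ⇐φ x , ⇐ψ y)
  ⊨-invariant dne (Kv c) (h , h') =
    BisimHalf-reflects-Kv dne c h' , BisimHalf-reflects-Kv dne c h
  ⊨-invariant dne ([ c ] φ) (h , h') =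
    ⊨-invariant dne φ (BisimHalf-restrict c h , BisimHalf-restrict c h')

  [_]*_ : List Const → Form → Form
  [ [] ]* φ = φ
  [ c ∷ C ]* φ = [ c ] [ C ]* φ

  distinguishable⇒⊨ : (C : List Const) (d : Const) {M : Model} {s : S M} →
    Distinguishable M s C d → M , s ⊨ ([ C ]* (¬f Kv d))
  distinguishable⇒⊨ [] d (t , [] , s≠t) kv = s≠t (kv t)
  distinguishable⇒⊨ (c ∷ C) d w = distinguishable⇒⊨ C d (distinguishable-restrict w)

  ⊨⇒distinguishable : DoubleNegationElimination 0ℓ → (C : List Const) (d : Const) →
    {M : Model} {s : S M} → M , s ⊨ ([ C ]* (¬f Kv d)) → Distinguishable M s C d
  ⊨⇒distinguishable dne [] d ¬kv = let (t , s≠t) = ¬∀⇒∃¬ dne ¬kv in t , [] , s≠t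
  ⊨⇒distinguishable dne (c ∷ C) d sat = restrict-distinguishable (⊨⇒distinguishable dne C d sat)

  theory-inclusion⇒BisimHalf : DoubleNegationElimination 0ℓ →
    {M : Model} {s : S M} {M' : Model} {s' : S M'} →
    (∀ φ → M , s ⊨ φ → M' , s' ⊨ φ) → BisimHalf M s M' s'
  theory-inclusion⇒BisimHalf dne ⊆ C d w =
    ⊨⇒distinguishable dne C d (⊆ ([ C ]* (¬f Kv d)) (distinguishable⇒⊨ C d w))

theorem2 : ExcludedMiddle 0ℓ →
    (Const : Set) →
    (M : Language.Model Const) (s : Language.Model.S M) →
    (M' : Language.Model Const) (s' : Language.Model.S M') →
    (Language.SameTheory Const M s M' s' → Language.Bisimilar Const M s M' s') ×
    (Language.Bisimilar Const M s M' s' → Language.SameTheory Const M s M' s')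
theorem2 em Const M s M' s' =
  (λ same → theory-inclusion⇒BisimHalf dne (λ φ → proj₁ (same φ))
          , theory-inclusion⇒BisimHalf dne (λ φ → proj₂ (same φ))) ,
  (λ bisim φ → ⊨-invariant dne φ bisim)
  where dne = em⇒dne em
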